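{- Let $k\ge 1$ and $t_0,\dots,t_{k-1}$ be positive integers. Let $p$ be the maximal nonnegative integer such that for all $1\le n\le p$ a good palindromic partition of $\{1,\dots,n\}$ with respect to $(t_0,\dots,t_{k-1})$ exists, and let $q$ be the minimal positive integer such that for all $n\ge q$ no good palindromic partition of $\{1,\dots,n\}$ exists. Then $q-p$ is an odd positive integer; there is no good palindromic partition for $n=p+1$, and for the integers $n$ with $p<n<q$ the existence of a good palindromic partition of $\{1,\dots,n\}$ alternates, i.e. a good palindromic partition of $\{1,\dots,n\}$ exists if and only if $n-p$ is even; and for all $n\ge q$ none exists.
   Context: An arithmetic progression of length $t$ is a set $\{a+id : i=0,\dots,t-1\}$ with $a,d$ positive integers. A good partition of $\{1,\dots,n\}$ with respect to $(t_0,\dots,t_{k-1})$ is a tuple $(P_0,\dots,P_{k-1})$ of pairwise disjoint (possibly empty) sets with union $\{1,\dots,n\}$ such that no $P_i$ contains an arithmetic progression of length $t_i$. It is palindromic if for every $v\in\{1,\dots,n\}$ and every $i$, $v\in P_i$ iff $n+1-v\in P_i$. (By van der Waerden's theorem there is some $n$ such that no good partition exists for any $n'\ge n$, so $q$ exists.) -}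

module Defs where

open import Data.Nat using (ℕ; zero; suc; _+_; _*_; _∸_; _≤_; _<_; _≥_)
open import Data.Fin using (Fin)
open import Data.Product using (Σ; ∃; _×_; _,_)
open import Relation.Binary.PropositionalEquality using (_≡_)
open import Relation.Nullary using (¬_)

-- A partition (P_0,…,P_{k-1}) of {1,…,n} into pairwise disjoint, possibly
-- empty sets is the same as a colouring of {1,…,n} by Fin k:
-- v ∈ P_i  iff  c v ≡ i.  Values of c outside {1,…,n} are irrelevant.
Colouring : ℕ → Set
Colouring k = ℕ → Fin k

ContainsAP : ∀ {k} → ℕ → Colouring k → Fin k → ℕ → Set
ContainsAP n c i t =
  Σ ℕ λ a → Σ ℕ λ d → 1 ≤ a × 1 ≤ d ×
    (∀ j → j < t → (1 ≤ a + j * d × a + j * d ≤ n) × c (a + j * d) ≡ i)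

Good : ∀ {k} → (Fin k → ℕ) → ℕ → Colouring k → Set
Good t n c = ∀ i → ¬ ContainsAP n c i (t i)

Palindromic : ∀ {k} → ℕ → Colouring k → Set
Palindromic n c = ∀ v → 1 ≤ v → v ≤ n → c v ≡ c (suc n ∸ v)

GoodPal : ∀ {k} → (Fin k → ℕ) → ℕ → Set
GoodPal t n = ∃ λ c → Good t n c × Palindromic n c

AllUpTo : ∀ {k} → (Fin k → ℕ) → ℕ → Set
AllUpTo t p = ∀ n → 1 ≤ n → n ≤ p → GoodPal t n

IsP : ∀ {k} → (Fin k → ℕ) → ℕ → Set
IsP t p = AllUpTo t p × (∀ m → AllUpTo t m → m ≤ p)

NoneFrom : ∀ {k} → (Fin k → ℕ) → ℕ → Set
NoneFrom t q = ∀ n → n ≥ q → ¬ GoodPal t n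

IsQ : ∀ {k} → (Fin k → ℕ) → ℕ → Set
IsQ t q = 1 ≤ q × NoneFrom t q × (∀ m → 1 ≤ m → NoneFrom t m → q ≤ m)

-- Deleting the two end points of a good palindromic partition of {1,…,n+2}
-- and shifting by one gives a good palindromic partition of {1,…,n}. So the
-- set of n admitting one is closed under n+2 ↦ n. By maximality of p there is
-- none for p+1, hence none for p+1+2j; by minimality of q (and decidability of
-- existence, a finite search) there is one for q−1, hence for q−1−2j. Thus
-- q−1−p is even, and between p and q existence is decided by the parity of n−p.
module Submission where

open import Defs
open import Data.Nat using (ℕ; zero; suc; _+_; _*_; _∸_; _≤_; _<_; _≥_; z≤n; s≤s; _≤?_; _≟_; z<s)
open import Data.Nat.Properties
open import Data.Nat.Divisibility using (_∣_; divides; ∣-refl; ∣m∣n⇒∣m+n; ∣m+n∣m⇒∣n)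
open import Data.Fin using (Fin)
import Data.Fin.Properties as Fin
open import Data.Product using (Σ; ∃; _×_; _,_; proj₁; proj₂)
open import Data.Sum using (_⊎_; inj₁; inj₂)
open import Relation.Binary.PropositionalEquality using (_≡_; refl; sym; trans; cong; subst; module ≡-Reasoning)
open import Relation.Nullary using (¬_; Dec; yes; no; contradiction)
open import Relation.Nullary.Decidable using (map′; _×-dec_; _→-dec_; ¬?)
open import Function.Base using (_∘_; id)
open import Function.Bundles using (_⇔_; mk⇔)

module _ {k : ℕ} where

  AgreeOn : ℕ → Colouring k → Colouring k → Set
  AgreeOn m c c′ = ∀ v → 1 ≤ v → v ≤ m → c v ≡ c′ v

  DependsOnlyOn : ℕ → (Colouring k → Set) → Set
  DependsOnlyOn m Q = ∀ c c′ → AgreeOn m c c′ → Q c → Q c′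

  recolour : Colouring k → ℕ → Fin k → Colouring k
  recolour c m i v with v ≟ m
  ... | yes _ = i
  ... | no  _ = c v

  recolour-agree : ∀ {m c c′} i → AgreeOn m c c′ →
                   AgreeOn (suc m) (recolour c (suc m) i) (recolour c′ (suc m) i)
  recolour-agree {m} i c≈c′ v 1≤v v≤1+m with v ≟ suc m
  ... | yes _   = refl
  ... | no  v≢  = c≈c′ v 1≤v (m<1+n⇒m≤n (≤∧≢⇒< v≤1+m v≢))

  recolour-self : ∀ (c : Colouring k) m v → c v ≡ recolour c m (c m) v
  recolour-self c m v with v ≟ m
  ... | yes refl = refl
  ... | no  _    = refl

  ∃-colouring? : Colouring k → ∀ m {Q : Colouring k → Set} →
                 DependsOnlyOn m Q → (∀ c → Dec (Q c)) → Dec (∃ Q)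
  ∃-colouring? c₀ zero {Q} Q-local Q? with Q? c₀
  ... | yes q = yes (c₀ , q)
  ... | no ¬q = no λ (c , q) → ¬q (Q-local c c₀ (λ v 1≤v v≤0 → contradiction v≤0 (<⇒≱ 1≤v)) q)
  ∃-colouring? c₀ (suc m) {Q} Q-local Q? =
    map′ (λ (i , c , q) → recolour c (suc m) i , q)
         (λ (c , q) → c (suc m) , c , Q-local c _ (λ v _ _ → recolour-self c (suc m) v) q)
         (Fin.any? λ i → ∃-colouring? c₀ m
            (λ c c′ c≈c′ → Q-local _ _ (recolour-agree i c≈c′))
            (λ c → Q? (recolour c (suc m) i)))

  ProgressionIn : ℕ → Colouring k → Fin k → ℕ → ℕ → ℕ → Set
  ProgressionIn n c i t a d =
    1 ≤ a × 1 ≤ d × (∀ j → j < t → (1 ≤ a + j * d × a + j * d ≤ n) × c (a + j * d) ≡ i)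

  progressionIn? : ∀ n c i t a d → Dec (ProgressionIn n c i t a d)
  progressionIn? n c i t a d =
    (1 ≤? a) ×-dec (1 ≤? d) ×-dec
    map′ (λ h j → h {j}) (λ h {j} → h j)
         (allUpTo? (λ j → ((1 ≤? a + j * d) ×-dec (a + j * d ≤? n)) ×-dec (c (a + j * d) Fin.≟ i)) t)

  progressionIn-start≤ : ∀ {n c i t a d} → ProgressionIn n c i (suc t) a d → a ≤ n
  progressionIn-start≤ {n} {a = a} (_ , _ , ap) = subst (_≤ n) (+-identityʳ a) (proj₂ (proj₁ (ap 0 z<s)))

  -- For t = 1 the difference is irrelevant and may be taken to be 1.
  progressionIn-bounded : ∀ {n c i t a d} → 1 ≤ t → ProgressionIn n c i t a d →
                          a < suc n × ∃ λ d′ → d′ < suc n × ProgressionIn n c i t a d′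
  progressionIn-bounded {n} {c} {t = suc zero} {a} _ P@(1≤a , _ , ap) =
    s≤s a≤n , 1 , s≤s (≤-trans 1≤a a≤n) , 1≤a , s≤s z≤n , λ { zero _ → ap 0 z<s ; (suc _) (s≤s ()) }
    where
    a≤n : a ≤ n
    a≤n = progressionIn-start≤ {c = c} P
  progressionIn-bounded {n} {c} {t = suc (suc _)} {a} {d} _ P@(_ , _ , ap) =
    s≤s (progressionIn-start≤ {c = c} P) , d , s≤s d≤n , P
    where
    d≤n : d ≤ n
    d≤n = ≤-trans (m≤n+m d a) (subst (λ x → a + x ≤ n) (*-identityˡ d) (proj₂ (proj₁ (ap 1 (s≤s z<s)))))

  containsAP? : ∀ n c i {t} → 1 ≤ t → Dec (ContainsAP n c i t)
  containsAP? n c i {t} 1≤t =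
    map′ (λ (a , _ , d , _ , ap) → a , d , ap) bounded
         (anyUpTo? (λ a → anyUpTo? (progressionIn? n c i t a) (suc n)) (suc n))
    where
    bounded : ContainsAP n c i t → ∃ λ a → a < suc n × ∃ λ d → d < suc n × ProgressionIn n c i t a d
    bounded (a , d , ap) = a , progressionIn-bounded {c = c} 1≤t ap

  palindromic? : ∀ n (c : Colouring k) → Dec (Palindromic n c)
  palindromic? n c =
    map′ (λ h v 1≤v v≤n → h (s≤s v≤n) 1≤v v≤n) (λ p {v} _ → p v)
         (allUpTo? (λ v → (1 ≤? v) →-dec (v ≤? n) →-dec (c v Fin.≟ c (suc n ∸ v))) (suc n))

mirror-range : ∀ {n v} → 1 ≤ v → v ≤ n → 1 ≤ suc n ∸ v × suc n ∸ v ≤ n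
mirror-range {n} 1≤v v≤n = m<n⇒0<n∸m (s≤s v≤n) , ∸-monoʳ-≤ (suc n) 1≤v

2∣n⊎2∣1+n : ∀ n → 2 ∣ n ⊎ 2 ∣ suc n
2∣n⊎2∣1+n zero = inj₁ (divides 0 refl)
2∣n⊎2∣1+n (suc n) with 2∣n⊎2∣1+n n
... | inj₁ 2∣n   = inj₂ (∣m∣n⇒∣m+n ∣-refl 2∣n)
... | inj₂ 2∣1+n = inj₁ 2∣1+n

∸-split : ∀ {m n o} → m ≤ n → n ≤ o → o ∸ m ≡ (n ∸ m) + (o ∸ n)
∸-split {m} {n} {o} m≤n n≤o = begin
  o ∸ m               ≡⟨ cong (_∸ m) (m+[n∸m]≡n n≤o) ⟨
  (n + (o ∸ n)) ∸ m   ≡⟨ +-∸-comm (o ∸ n) m≤n ⟩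
  (n ∸ m) + (o ∸ n)   ∎
  where open ≡-Reasoning

suc-even-gap : ∀ {m n} → m ≤ n → 2 ∣ n ∸ m → Σ ℕ λ j → suc n ≡ m + (2 * j + 1)
suc-even-gap {m} {n} m≤n (divides j n∸m≡j*2) = j , (begin
  suc n               ≡⟨ cong suc (m+[n∸m]≡n m≤n) ⟨
  suc (m + (n ∸ m))   ≡⟨ cong (λ x → suc (m + x)) n∸m≡j*2 ⟩
  suc (m + j * 2)     ≡⟨ +-suc m (j * 2) ⟨
  m + suc (j * 2)     ≡⟨ cong (m +_) (trans (+-comm 1 (j * 2)) (cong (_+ 1) (*-comm j 2))) ⟩
  m + (2 * j + 1)     ∎)
  where open ≡-Reasoning

module _ {k : ℕ} (t : Fin k → ℕ) where

  goodPalindromic-local : ∀ n → DependsOnlyOn n (λ c → Good t n c × Palindromic n c)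
  goodPalindromic-local n c c′ c≈c′ (good , pal) = good′ , pal′
    where
    good′ : Good t n c′
    good′ i (a , d , 1≤a , 1≤d , ap) = good i (a , d , 1≤a , 1≤d , λ j j<t →
      let (1≤v , v≤n) , c′v≡i = ap j j<t in (1≤v , v≤n) , trans (c≈c′ _ 1≤v v≤n) c′v≡i)
    pal′ : Palindromic n c′
    pal′ v 1≤v v≤n =
      let 1≤w , w≤n = mirror-range 1≤v v≤n
      in trans (sym (c≈c′ v 1≤v v≤n)) (trans (pal v 1≤v v≤n) (c≈c′ _ 1≤w w≤n))

  good? : (∀ i → 1 ≤ t i) → ∀ n c → Dec (Good t n c)
  good? t≥1 n c = Fin.all? λ i → ¬? (containsAP? n c i (t≥1 i))

  goodPal? : Fin k → (∀ i → 1 ≤ t i) → ∀ n → Dec (GoodPal t n)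
  goodPal? i₀ t≥1 n =
    ∃-colouring? (λ _ → i₀) n (goodPalindromic-local n) (λ c → good? t≥1 n c ×-dec palindromic? n c)

  goodPal-0 : Fin k → (∀ i → 1 ≤ t i) → GoodPal t 0
  goodPal-0 i₀ t≥1 = (λ _ → i₀) , no-progression , λ v 1≤v v≤0 → contradiction v≤0 (<⇒≱ 1≤v)
    where
    no-progression : Good t 0 (λ _ → i₀)
    no-progression i (_ , _ , _ , _ , ap) = let (1≤a , a≤0) , _ = ap 0 (t≥1 i) in <⇒≱ 1≤a a≤0

  goodPal-shrink : ∀ {n} → GoodPal t (2 + n) → GoodPal t n
  goodPal-shrink {n} (c , good , pal) = (λ v → c (suc v)) , good′ , pal′
    where
    good′ : Good t n (λ v → c (suc v))
    good′ i (a , d , _ , 1≤d , ap) = good i (suc a , d , s≤s z≤n , 1≤d , λ j j<t →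
      let (_ , v≤n) , cv≡i = ap j j<t in (s≤s z≤n , m≤n⇒m≤1+n (s≤s v≤n)) , cv≡i)
    pal′ : Palindromic n (λ v → c (suc v))
    pal′ v 1≤v v≤n = trans (pal (suc v) (s≤s z≤n) (s≤s (m≤n⇒m≤1+n v≤n)))
                           (cong c (+-∸-assoc 1 (m≤n⇒m≤1+n v≤n)))

  goodPal-down : ∀ {m n} → m ≤ n → 2 ∣ n ∸ m → GoodPal t n → GoodPal t m
  goodPal-down {m} {n} m≤n (divides j n∸m≡j*2) =
    down j ∘ subst (GoodPal t) (trans (sym (m∸n+n≡m m≤n)) (cong (_+ m) n∸m≡j*2))
    where
    down : ∀ j → GoodPal t (j * 2 + m) → GoodPal t m
    down zero    = id
    down (suc j) = down j ∘ goodPal-shrink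

  IsP⇒¬GoodPal-suc : ∀ {p} → IsP t p → ¬ GoodPal t (suc p)
  IsP⇒¬GoodPal-suc {p} (all≤p , maximal) g = 1+n≰n (maximal (suc p) all≤1+p)
    where
    all≤1+p : AllUpTo t (suc p)
    all≤1+p n 1≤n n≤1+p with m≤n⇒m<n∨m≡n n≤1+p
    ... | inj₁ n<1+p = all≤p n 1≤n (m<1+n⇒m≤n n<1+p)
    ... | inj₂ refl  = g

  noneFrom-pred : ∀ {q} → NoneFrom t (suc q) → ¬ GoodPal t q → NoneFrom t q
  noneFrom-pred none ¬g n n≥q with m≤n⇒m<n∨m≡n n≥q
  ... | inj₁ q<n  = none n q<n
  ... | inj₂ refl = ¬g

  IsQ⇒¬NoneFrom-pred : Fin k → (∀ i → 1 ≤ t i) → ∀ {q} → IsQ t (suc q) → ¬ NoneFrom t q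
  IsQ⇒¬NoneFrom-pred i₀ t≥1 {zero}  _                 none = none 0 z≤n (goodPal-0 i₀ t≥1)
  IsQ⇒¬NoneFrom-pred i₀ t≥1 {suc q} (_ , _ , minimal) none = 1+n≰n (minimal (suc q) (s≤s z≤n) none)

  IsQ⇒GoodPal-pred : Fin k → (∀ i → 1 ≤ t i) → ∀ {q} → IsQ t (suc q) → GoodPal t q
  IsQ⇒GoodPal-pred i₀ t≥1 {q} isQ@(_ , none , _) with goodPal? i₀ t≥1 q
  ... | yes g  = g
  ... | no ¬g = contradiction (noneFrom-pred none ¬g) (IsQ⇒¬NoneFrom-pred i₀ t≥1 isQ)

  IsP∧IsQ⇒≤ : ∀ {p q} → IsP t p → IsQ t (suc q) → p ≤ q
  IsP∧IsQ⇒≤ {p} {q} (all≤p , _) (_ , none , _) with p ≤? q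
  ... | yes p≤q = p≤q
  ... | no  p≰q = contradiction (all≤p p (≤-trans (s≤s z≤n) q<p) ≤-refl) (none p q<p)
    where
    q<p : q < p
    q<p = ≰⇒> p≰q

  goodPal-parity : ∀ {p} → ¬ GoodPal t (suc p) → ∀ r → GoodPal t (p + r) → 2 ∣ r
  goodPal-parity _ zero _ = divides 0 refl
  goodPal-parity {p} ¬g (suc r) g with 2∣n⊎2∣1+n r
  ... | inj₂ 2∣1+r = 2∣1+r
  ... | inj₁ 2∣r   = contradiction
    (goodPal-down (s≤s (m≤m+n p r)) (subst (2 ∣_) (sym (m+n∸m≡n p r)) 2∣r) (subst (GoodPal t) (+-suc p r) g)) ¬g

corollary4p3 : (k : ℕ) → 1 ≤ k → (t : Fin k → ℕ) → (∀ i → 1 ≤ t i) →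
    (p q : ℕ) → IsP t p → IsQ t q →
    (Σ ℕ λ j → q ≡ p + (2 * j + 1)) ×
    ¬ GoodPal t (p + 1) ×
    (∀ n → p < n → n < q → (GoodPal t n ⇔ 2 ∣ (n ∸ p))) ×
    (∀ n → n ≥ q → ¬ GoodPal t n)
corollary4p3 (suc k) _ t t≥1 p (suc q′) isP isQ@(_ , none , _) =
  suc-even-gap p≤q′ 2∣q′∸p , ¬GoodPal[p+1] , between , none
  where
  ¬GoodPal[1+p] : ¬ GoodPal t (suc p)
  ¬GoodPal[1+p] = IsP⇒¬GoodPal-suc t isP

  ¬GoodPal[p+1] : ¬ GoodPal t (p + 1)
  ¬GoodPal[p+1] = ¬GoodPal[1+p] ∘ subst (GoodPal t) (+-comm p 1)

  goodPal⇒2∣ : ∀ {n} → p ≤ n → GoodPal t n → 2 ∣ n ∸ p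
  goodPal⇒2∣ p≤n = goodPal-parity t ¬GoodPal[1+p] _ ∘ subst (GoodPal t) (sym (m+[n∸m]≡n p≤n))

  p≤q′ : p ≤ q′
  p≤q′ = IsP∧IsQ⇒≤ t isP isQ

  GoodPal[q′] : GoodPal t q′
  GoodPal[q′] = IsQ⇒GoodPal-pred t Data.Fin.zero t≥1 isQ

  2∣q′∸p : 2 ∣ q′ ∸ p
  2∣q′∸p = goodPal⇒2∣ p≤q′ GoodPal[q′]

  between : ∀ n → p < n → n < suc q′ → GoodPal t n ⇔ 2 ∣ n ∸ p
  between n p<n (s≤s n≤q′) = mk⇔ (goodPal⇒2∣ (<⇒≤ p<n)) λ 2∣n∸p →
    goodPal-down t n≤q′ (∣m+n∣m⇒∣n (subst (2 ∣_) (∸-split (<⇒≤ p<n) n≤q′) 2∣q′∸p) 2∣n∸p) GoodPal[q′]
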